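{- Let $t$ be an indeterminate (equivalently, an arbitrary rational or integer parameter), and define the polynomials \[ \begin{aligned} x_1 &= 4t^4 + 18t^3 + 34t^2 + 526t + 378, & x_2 &= 3t^4 + 16t^3 - 86t^2 - 32t + 579,\\ x_3 &= t^4 - 12t^3 + 74t^2 + 1020t + 1317, & x_4 &= 2t^4 + 42t^3 + 110t^2 + 230t + 1056,\\ y_1 &= 4t^4 + 14t^3 - 122t^2 - 958t - 1338, & y_2 &= 2t^4 - 14t^3 - 242t^2 - 658t - 48,\\ y_3 &= 3t^4 + 40t^3 + 74t^2 - 696t - 861, & y_4 &= t^4 + 44t^3 + 202t^2 + 164t - 891. \end{aligned} \] Then $\sum_{i=1}^4 x_i^r=\sum_{i=1}^4 y_i^r$ holds identically in $t$ for $r=2,4,6$. Consequently, setting $x_{i+4}=-x_i$ and $y_{i+4}=-y_i$ for $i=1,\dots,4$, one has $\sum_{i=1}^8 x_i^r=\sum_{i=1}^8 y_i^r$ identically in $t$ for $r=1,2,\dots,7$, i.e. these give a parametric ideal solution of degree 4 of the Tarry–Escott problem of degree 7.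
   Context: The Tarry–Escott problem of degree $k$ asks for two distinct multisets of integers $\{x_1,\dots,x_s\}$ and $\{y_1,\dots,y_s\}$ with $\sum_{i=1}^s x_i^r=\sum_{i=1}^s y_i^r$ for $r=1,\dots,k$; a solution with $s=k+1$ is called ideal. -}

module Defs where

open import Data.Nat using (ℕ)
open import Data.Integer using (ℤ; +_; -_; _+_; _-_; _*_; _^_)
open import Data.Fin using (Fin; zero; suc)
open import Data.Vec using (Vec; []; _∷_; map; _++_)

powerSum : {n : ℕ} → Vec ℤ n → ℕ → ℤ
powerSum [] r = + 0
powerSum (a ∷ v) r = a ^ r + powerSum v r

xs : ℤ → Vec ℤ 4
xs t =
    (+ 4 * t ^ 4 + + 18 * t ^ 3 + + 34 * t ^ 2 + + 526 * t + + 378)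
  ∷ (+ 3 * t ^ 4 + + 16 * t ^ 3 - + 86 * t ^ 2 - + 32 * t + + 579)
  ∷ (t ^ 4 - + 12 * t ^ 3 + + 74 * t ^ 2 + + 1020 * t + + 1317)
  ∷ (+ 2 * t ^ 4 + + 42 * t ^ 3 + + 110 * t ^ 2 + + 230 * t + + 1056)
  ∷ []

ys : ℤ → Vec ℤ 4
ys t =
    (+ 4 * t ^ 4 + + 14 * t ^ 3 - + 122 * t ^ 2 - + 958 * t - + 1338)
  ∷ (+ 2 * t ^ 4 - + 14 * t ^ 3 - + 242 * t ^ 2 - + 658 * t - + 48)
  ∷ (+ 3 * t ^ 4 + + 40 * t ^ 3 + + 74 * t ^ 2 - + 696 * t - + 861)
  ∷ (t ^ 4 + + 44 * t ^ 3 + + 202 * t ^ 2 + + 164 * t - + 891)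
  ∷ []

xs8 : ℤ → Vec ℤ 8
xs8 t = xs t ++ map -_ (xs t)

ys8 : ℤ → Vec ℤ 8
ys8 t = ys t ++ map -_ (ys t)

-- Each x_i, y_i is a polynomial in t, so the three identities for r = 2, 4, 6 are
-- polynomial identities; they are checked by expanding both sides into coefficient
-- lists, which agree on the nose. Appending the negatives of the entries kills every
-- odd power sum and doubles every even one, so the eight-term sums agree for r = 1, …, 7.
module Submission where

open import Defs
open import Data.Nat using (ℕ; _≤_; zero; suc; _*_; s≤s)
open import Data.Integer
  using (ℤ; +_; -_; _+_; _-_; _^_; 0ℤ; 1ℤ; _≟_)
  renaming (_*_ to _*ℤ_)
open import Data.Integer.Properties
  using (+-identityˡ; +-identityʳ; +-assoc; +-inverseʳ; *-zeroʳ; neg-distribˡ-*; ^-*-assoc)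
open import Data.Integer.Tactic.RingSolver using (solve-∀)
open import Data.List using (List; []; _∷_)
import Data.List as List
open import Data.List.Properties using (≡-dec)
open import Data.Product using (_×_; _,_)
open import Data.Vec using (Vec; []; _∷_; map; _++_)
open import Relation.Binary.Definitions using (DecidableEquality)
open import Relation.Binary.PropositionalEquality
  using (_≡_; refl; sym; trans; cong; cong₂; module ≡-Reasoning)
open import Relation.Nullary.Decidable using (True; toWitness)

open ≡-Reasoning

-- Polynomials over ℤ as coefficient lists, constant term first

Poly : Set
Poly = List ℤ

horner : Poly → ℤ → ℤ
horner []      t = 0ℤ
horner (a ∷ p) t = a + t *ℤ horner p t

_≟ᴾ_ : DecidableEquality Poly
_≟ᴾ_ = ≡-dec _≟_

infixl 6 _⊕_
infixl 7 _⊗_ _⊙_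
infixr 8 _⊛_

_⊕_ : Poly → Poly → Poly
[]      ⊕ q       = q
(a ∷ p) ⊕ []      = a ∷ p
(a ∷ p) ⊕ (b ∷ q) = a + b ∷ p ⊕ q

_⊙_ : ℤ → Poly → Poly
c ⊙ p = List.map (c *ℤ_) p

⊝_ : Poly → Poly
⊝ p = List.map -_ p

_⊗_ : Poly → Poly → Poly
[]      ⊗ q = []
(a ∷ p) ⊗ q = a ⊙ q ⊕ (0ℤ ∷ p ⊗ q)

_⊛_ : Poly → ℕ → Poly
p ⊛ zero  = 1ℤ ∷ []
p ⊛ suc n = p ⊗ p ⊛ n

horner-⊕ : ∀ p q t → horner (p ⊕ q) t ≡ horner p t + horner q t
horner-⊕ []      q       t = sym (+-identityˡ _)
horner-⊕ (a ∷ p) []      t = sym (+-identityʳ _)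
horner-⊕ (a ∷ p) (b ∷ q) t = begin
  a + b + t *ℤ horner (p ⊕ q) t                 ≡⟨ cong (λ s → a + b + t *ℤ s) (horner-⊕ p q t) ⟩
  a + b + t *ℤ (horner p t + horner q t)        ≡⟨ shuffle a b t (horner p t) (horner q t) ⟩
  a + t *ℤ horner p t + (b + t *ℤ horner q t)   ∎
  where
  shuffle : ∀ a b t x y → a + b + t *ℤ (x + y) ≡ a + t *ℤ x + (b + t *ℤ y)
  shuffle = solve-∀

horner-⊙ : ∀ c p t → horner (c ⊙ p) t ≡ c *ℤ horner p t
horner-⊙ c []      t = sym (*-zeroʳ c)
horner-⊙ c (a ∷ p) t = begin
  c *ℤ a + t *ℤ horner (c ⊙ p) t   ≡⟨ cong (λ s → c *ℤ a + t *ℤ s) (horner-⊙ c p t) ⟩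
  c *ℤ a + t *ℤ (c *ℤ horner p t)  ≡⟨ distrib c a t (horner p t) ⟩
  c *ℤ (a + t *ℤ horner p t)       ∎
  where
  distrib : ∀ c a t x → c *ℤ a + t *ℤ (c *ℤ x) ≡ c *ℤ (a + t *ℤ x)
  distrib = solve-∀

horner-⊝ : ∀ p t → horner (⊝ p) t ≡ - horner p t
horner-⊝ []      t = refl
horner-⊝ (a ∷ p) t = begin
  - a + t *ℤ horner (⊝ p) t   ≡⟨ cong (λ s → - a + t *ℤ s) (horner-⊝ p t) ⟩
  - a + t *ℤ (- horner p t)   ≡⟨ negate a t (horner p t) ⟩
  - (a + t *ℤ horner p t)     ∎
  where
  negate : ∀ a t x → - a + t *ℤ (- x) ≡ - (a + t *ℤ x)
  negate = solve-∀

horner-⊗ : ∀ p q t → horner (p ⊗ q) t ≡ horner p t *ℤ horner q t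
horner-⊗ []      q t = refl
horner-⊗ (a ∷ p) q t = begin
  horner (a ⊙ q ⊕ (0ℤ ∷ p ⊗ q)) t                        ≡⟨ horner-⊕ (a ⊙ q) (0ℤ ∷ p ⊗ q) t ⟩
  horner (a ⊙ q) t + (0ℤ + t *ℤ horner (p ⊗ q) t)        ≡⟨ cong₂ (λ u v → u + (0ℤ + t *ℤ v))
                                                              (horner-⊙ a q t) (horner-⊗ p q t) ⟩
  a *ℤ horner q t + (0ℤ + t *ℤ (horner p t *ℤ horner q t)) ≡⟨ distrib a t (horner p t) (horner q t) ⟩
  (a + t *ℤ horner p t) *ℤ horner q t                     ∎
  where
  distrib : ∀ a t x y → a *ℤ y + (0ℤ + t *ℤ (x *ℤ y)) ≡ (a + t *ℤ x) *ℤ y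
  distrib = solve-∀

horner-⊛ : ∀ p n t → horner (p ⊛ n) t ≡ horner p t ^ n
horner-⊛ p zero    t = cong (_+_ 1ℤ) (*-zeroʳ t)
horner-⊛ p (suc n) t = trans (horner-⊗ p (p ⊛ n) t) (cong (horner p t *ℤ_) (horner-⊛ p n t))

-- Polynomial expressions in one variable; ⟦_⟧ follows the syntax exactly, so the
-- entries of xs and ys are definitionally the values of the expressions below.

infixl 6 _:+_ _:-_
infixl 7 _:*_
infixr 8 _:^_

data Expr : Set where
  con  : ℤ → Expr
  var  : Expr
  _:+_ : Expr → Expr → Expr
  _:-_ : Expr → Expr → Expr
  _:*_ : Expr → Expr → Expr
  _:^_ : Expr → ℕ → Expr

⟦_⟧ : Expr → ℤ → ℤ
⟦ con c  ⟧ t = c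
⟦ var    ⟧ t = t
⟦ e :+ f ⟧ t = ⟦ e ⟧ t + ⟦ f ⟧ t
⟦ e :- f ⟧ t = ⟦ e ⟧ t - ⟦ f ⟧ t
⟦ e :* f ⟧ t = ⟦ e ⟧ t *ℤ ⟦ f ⟧ t
⟦ e :^ n ⟧ t = ⟦ e ⟧ t ^ n

normalize : Expr → Poly
normalize (con c)  = c ∷ []
normalize var      = 0ℤ ∷ 1ℤ ∷ []
normalize (e :+ f) = normalize e ⊕ normalize f
normalize (e :- f) = normalize e ⊕ ⊝ normalize f
normalize (e :* f) = normalize e ⊗ normalize f
normalize (e :^ n) = normalize e ⊛ n

horner-normalize : ∀ e t → horner (normalize e) t ≡ ⟦ e ⟧ t
horner-normalize (con c)  t = trans (cong (_+_ c) (*-zeroʳ t)) (+-identityʳ c)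
horner-normalize var      t = linear t
  where
  linear : ∀ t → 0ℤ + t *ℤ (1ℤ + t *ℤ 0ℤ) ≡ t
  linear = solve-∀
horner-normalize (e :+ f) t = trans (horner-⊕ (normalize e) (normalize f) t)
  (cong₂ _+_ (horner-normalize e t) (horner-normalize f t))
horner-normalize (e :- f) t = begin
  horner (normalize e ⊕ ⊝ normalize f) t         ≡⟨ horner-⊕ (normalize e) (⊝ normalize f) t ⟩
  horner (normalize e) t + horner (⊝ normalize f) t ≡⟨ cong (_+_ (horner (normalize e) t)) (horner-⊝ (normalize f) t) ⟩
  horner (normalize e) t - horner (normalize f) t ≡⟨ cong₂ _-_ (horner-normalize e t) (horner-normalize f t) ⟩
  ⟦ e ⟧ t - ⟦ f ⟧ t                                ∎
horner-normalize (e :* f) t = trans (horner-⊗ (normalize e) (normalize f) t)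
  (cong₂ _*ℤ_ (horner-normalize e t) (horner-normalize f t))
horner-normalize (e :^ n) t = trans (horner-⊛ (normalize e) n t)
  (cong (_^ n) (horner-normalize e t))

⟦⟧-≡-by-normalize : ∀ e f → normalize e ≡ normalize f → ∀ t → ⟦ e ⟧ t ≡ ⟦ f ⟧ t
⟦⟧-≡-by-normalize e f eq t = begin
  ⟦ e ⟧ t                ≡⟨ sym (horner-normalize e t) ⟩
  horner (normalize e) t ≡⟨ cong (λ p → horner p t) eq ⟩
  horner (normalize f) t ≡⟨ horner-normalize f t ⟩
  ⟦ f ⟧ t                ∎

powerSumExpr : {n : ℕ} → Vec Expr n → ℕ → Expr
powerSumExpr []       r = con 0ℤ
powerSumExpr (e ∷ es) r = e :^ r :+ powerSumExpr es r

powerSum-map-⟦⟧ : ∀ {n} (es : Vec Expr n) r t →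
  powerSum (map (λ e → ⟦ e ⟧ t) es) r ≡ ⟦ powerSumExpr es r ⟧ t
powerSum-map-⟦⟧ []       r t = refl
powerSum-map-⟦⟧ (e ∷ es) r t = cong (_+_ (⟦ e ⟧ t ^ r)) (powerSum-map-⟦⟧ es r t)

-- The hypothesis is a decision rather than an equation proved by refl: the type
-- checker evaluates a decision in one reduction that shares the repeated subterms of
-- the two normal forms, whereas checking refl recomputes them and runs out of memory
-- for the sixth power sums below.
powerSum-≡-by-normalize : ∀ {n} (es fs : Vec Expr n) r →
  True (normalize (powerSumExpr es r) ≟ᴾ normalize (powerSumExpr fs r)) →
  ∀ t → powerSum (map (λ e → ⟦ e ⟧ t) es) r ≡ powerSum (map (λ f → ⟦ f ⟧ t) fs) r
powerSum-≡-by-normalize es fs r normal-forms-agree t = begin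
  powerSum (map (λ e → ⟦ e ⟧ t) es) r ≡⟨ powerSum-map-⟦⟧ es r t ⟩
  ⟦ powerSumExpr es r ⟧ t             ≡⟨ ⟦⟧-≡-by-normalize (powerSumExpr es r) (powerSumExpr fs r)
                                           (toWitness normal-forms-agree) t ⟩
  ⟦ powerSumExpr fs r ⟧ t             ≡⟨ sym (powerSum-map-⟦⟧ fs r t) ⟩
  powerSum (map (λ f → ⟦ f ⟧ t) fs) r ∎

neg-^-even : ∀ a n → (- a) ^ (2 * n) ≡ a ^ (2 * n)
neg-^-even a n = begin
  (- a) ^ (2 * n)   ≡⟨ sym (^-*-assoc (- a) 2 n) ⟩
  ((- a) ^ 2) ^ n   ≡⟨ cong (_^ n) (square a) ⟩
  (a ^ 2) ^ n       ≡⟨ ^-*-assoc a 2 n ⟩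
  a ^ (2 * n)       ∎
  where
  square : ∀ a → (- a) *ℤ ((- a) *ℤ 1ℤ) ≡ a *ℤ (a *ℤ 1ℤ)
  square = solve-∀

neg-^-odd : ∀ a n → (- a) ^ suc (2 * n) ≡ - a ^ suc (2 * n)
neg-^-odd a n = trans (cong (- a *ℤ_) (neg-^-even a n)) (sym (neg-distribˡ-* a (a ^ (2 * n))))

powerSum-++ : ∀ {m n} (u : Vec ℤ m) (w : Vec ℤ n) r →
  powerSum (u ++ w) r ≡ powerSum u r + powerSum w r
powerSum-++ []      w r = sym (+-identityˡ _)
powerSum-++ (a ∷ u) w r = trans (cong (_+_ (a ^ r)) (powerSum-++ u w r))
  (sym (+-assoc (a ^ r) (powerSum u r) (powerSum w r)))

powerSum-map-neg-even : ∀ {k} (v : Vec ℤ k) n →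
  powerSum (map -_ v) (2 * n) ≡ powerSum v (2 * n)
powerSum-map-neg-even []      n = refl
powerSum-map-neg-even (a ∷ v) n = cong₂ _+_ (neg-^-even a n) (powerSum-map-neg-even v n)

powerSum-map-neg-odd : ∀ {k} (v : Vec ℤ k) n →
  powerSum (map -_ v) (suc (2 * n)) ≡ - powerSum v (suc (2 * n))
powerSum-map-neg-odd []      n = refl
powerSum-map-neg-odd (a ∷ v) n = begin
  (- a) ^ r + powerSum (map -_ v) r ≡⟨ cong₂ _+_ (neg-^-odd a n) (powerSum-map-neg-odd v n) ⟩
  - a ^ r + - powerSum v r          ≡⟨ neg-+ (a ^ r) (powerSum v r) ⟩
  - (a ^ r + powerSum v r)          ∎
  where
  r = suc (2 * n)
  neg-+ : ∀ x y → - x + - y ≡ - (x + y)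
  neg-+ = solve-∀

powerSum-symmetric-odd : ∀ {k} (v : Vec ℤ k) n → powerSum (v ++ map -_ v) (suc (2 * n)) ≡ 0ℤ
powerSum-symmetric-odd v n = begin
  powerSum (v ++ map -_ v) r         ≡⟨ powerSum-++ v (map -_ v) r ⟩
  powerSum v r + powerSum (map -_ v) r ≡⟨ cong (_+_ (powerSum v r)) (powerSum-map-neg-odd v n) ⟩
  powerSum v r - powerSum v r        ≡⟨ +-inverseʳ (powerSum v r) ⟩
  0ℤ                                 ∎
  where r = suc (2 * n)

powerSum-symmetric-even : ∀ {k} (v : Vec ℤ k) n →
  powerSum (v ++ map -_ v) (2 * n) ≡ powerSum v (2 * n) + powerSum v (2 * n)
powerSum-symmetric-even v n = trans (powerSum-++ v (map -_ v) (2 * n))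
  (cong (_+_ (powerSum v (2 * n))) (powerSum-map-neg-even v n))

symmetrize-odd : ∀ {k} (v w : Vec ℤ k) n →
  powerSum (v ++ map -_ v) (suc (2 * n)) ≡ powerSum (w ++ map -_ w) (suc (2 * n))
symmetrize-odd v w n = trans (powerSum-symmetric-odd v n) (sym (powerSum-symmetric-odd w n))

symmetrize-even : ∀ {k} (v w : Vec ℤ k) n → powerSum v (2 * n) ≡ powerSum w (2 * n) →
  powerSum (v ++ map -_ v) (2 * n) ≡ powerSum (w ++ map -_ w) (2 * n)
symmetrize-even v w n eq = begin
  powerSum (v ++ map -_ v) (2 * n)          ≡⟨ powerSum-symmetric-even v n ⟩
  powerSum v (2 * n) + powerSum v (2 * n)   ≡⟨ cong₂ _+_ eq eq ⟩
  powerSum w (2 * n) + powerSum w (2 * n)   ≡⟨ sym (powerSum-symmetric-even w n) ⟩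
  powerSum (w ++ map -_ w) (2 * n)          ∎

X Y : Vec Expr 4
X = con (+ 4) :* var :^ 4 :+ con (+ 18) :* var :^ 3 :+ con (+ 34) :* var :^ 2 :+ con (+ 526) :* var :+ con (+ 378)
  ∷ con (+ 3) :* var :^ 4 :+ con (+ 16) :* var :^ 3 :- con (+ 86) :* var :^ 2 :- con (+ 32) :* var :+ con (+ 579)
  ∷ var :^ 4 :- con (+ 12) :* var :^ 3 :+ con (+ 74) :* var :^ 2 :+ con (+ 1020) :* var :+ con (+ 1317)
  ∷ con (+ 2) :* var :^ 4 :+ con (+ 42) :* var :^ 3 :+ con (+ 110) :* var :^ 2 :+ con (+ 230) :* var :+ con (+ 1056)
  ∷ []
Y = con (+ 4) :* var :^ 4 :+ con (+ 14) :* var :^ 3 :- con (+ 122) :* var :^ 2 :- con (+ 958) :* var :- con (+ 1338)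
  ∷ con (+ 2) :* var :^ 4 :- con (+ 14) :* var :^ 3 :- con (+ 242) :* var :^ 2 :- con (+ 658) :* var :- con (+ 48)
  ∷ con (+ 3) :* var :^ 4 :+ con (+ 40) :* var :^ 3 :+ con (+ 74) :* var :^ 2 :- con (+ 696) :* var :- con (+ 861)
  ∷ var :^ 4 :+ con (+ 44) :* var :^ 3 :+ con (+ 202) :* var :^ 2 :+ con (+ 164) :* var :- con (+ 891)
  ∷ []

powerSum-xs-ys : ∀ r → True (normalize (powerSumExpr X r) ≟ᴾ normalize (powerSumExpr Y r)) →
  ∀ t → powerSum (xs t) r ≡ powerSum (ys t) r
powerSum-xs-ys = powerSum-≡-by-normalize X Y

mainTheorem4 :
    ((t : ℤ) →
        (powerSum (xs t) 2 ≡ powerSum (ys t) 2)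
      × (powerSum (xs t) 4 ≡ powerSum (ys t) 4)
      × (powerSum (xs t) 6 ≡ powerSum (ys t) 6))
    × ((t : ℤ) (r : ℕ) → 1 ≤ r → r ≤ 7 →
        powerSum (xs8 t) r ≡ powerSum (ys8 t) r)
mainTheorem4 = (λ t → equal-2 t , equal-4 t , equal-6 t) , equal-symmetrized
  where
  equal-2 : ∀ t → powerSum (xs t) 2 ≡ powerSum (ys t) 2
  equal-4 : ∀ t → powerSum (xs t) 4 ≡ powerSum (ys t) 4
  equal-6 : ∀ t → powerSum (xs t) 6 ≡ powerSum (ys t) 6
  equal-2 = powerSum-xs-ys 2 _
  equal-4 = powerSum-xs-ys 4 _
  equal-6 = powerSum-xs-ys 6 _

  equal-symmetrized : (t : ℤ) (r : ℕ) → 1 ≤ r → r ≤ 7 → powerSum (xs8 t) r ≡ powerSum (ys8 t) r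
  equal-symmetrized t 1 _ _ = symmetrize-odd (xs t) (ys t) 0
  equal-symmetrized t 2 _ _ = symmetrize-even (xs t) (ys t) 1 (equal-2 t)
  equal-symmetrized t 3 _ _ = symmetrize-odd (xs t) (ys t) 1
  equal-symmetrized t 4 _ _ = symmetrize-even (xs t) (ys t) 2 (equal-4 t)
  equal-symmetrized t 5 _ _ = symmetrize-odd (xs t) (ys t) 2
  equal-symmetrized t 6 _ _ = symmetrize-even (xs t) (ys t) 3 (equal-6 t)
  equal-symmetrized t 7 _ _ = symmetrize-odd (xs t) (ys t) 3
  equal-symmetrized t (suc (suc (suc (suc (suc (suc (suc (suc _)))))))) _
    (s≤s (s≤s (s≤s (s≤s (s≤s (s≤s (s≤s ())))))))
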